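{- Let $G$ be a $\{C_3,C_4\}$-free graph with maximum degree at most 3 and let $a^*,d^*:V(G)\to\{0,1\}$. Then $(G,a^*,d^*)$ is a YES-instance of $(1,1)$-Cluster Editing if and only if there is a matching $D$ of deletable edges of $G$ such that every connected component $C$ of $G-D$ is isomorphic to $P_1$, $P_2$ or $P_3$, and if $C\cong P_3$ then the non-edge of $G$ between the two end-vertices of $C$ is addable.
   Context: An edge $uv$ of $G$ is deletable if $d^*(u)=d^*(v)=1$; a non-edge $uv$ of $G$ is addable if $a^*(u)=a^*(v)=1$. $(G,a^*,d^*)$ is a YES-instance of $(1,1)$-Cluster Editing if there is a matching $D$ of deletable edges and a matching $A$ of addable non-edges such that $G-D+A$ is a vertex-disjoint union of cliques. $P_n$ denotes the path on $n$ vertices. A graph is $\{C_3,C_4\}$-free if it contains no 3-cycle and no 4-cycle as a subgraph. -}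

module Defs where

open import Data.Nat using (ℕ; zero; suc; _≤_)
open import Data.Fin using (Fin; toℕ; zero; suc)
open import Data.Bool using (Bool; true; false; _∧_; _∨_; not)
open import Data.List using (List; length; filterᵇ; allFin)
open import Data.Product using (Σ; ∃; _×_; _,_)
open import Data.Sum using (_⊎_)
open import Relation.Binary.PropositionalEquality using (_≡_; _≢_)
open import Relation.Binary.Construct.Closure.ReflexiveTransitive using (Star)
open import Function.Bundles using (_⇔_)
open import Function.Definitions using (Injective)

record Graph (n : ℕ) : Set where
  field
    adj     : Fin n → Fin n → Bool
    adj-sym : ∀ u v → adj u v ≡ adj v u
    irrefl  : ∀ v → adj v v ≡ false
open Graph public

Edge : ∀ {n} → (Fin n → Fin n → Bool) → Fin n → Fin n → Set
Edge R u v = R u v ≡ true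

degree : ∀ {n} → Graph n → Fin n → ℕ
degree G v = length (filterᵇ (adj G v) (allFin _))

MaxDegreeAtMost : ∀ {n} → Graph n → ℕ → Set
MaxDegreeAtMost G k = ∀ v → degree G v ≤ k

-- no 3-cycle as a subgraph (distinctness of u,v,w follows from irreflexivity)
C3-free : ∀ {n} → Graph n → Set
C3-free G = ∀ u v w → Edge (adj G) u v → Edge (adj G) v w → Edge (adj G) w u → Data.Empty.⊥
  where import Data.Empty

-- no 4-cycle as a subgraph: a-b-c-d-a with the four vertices distinct
-- (consecutive ones are distinct by irreflexivity; we require a ≢ c, b ≢ d)
C4-free : ∀ {n} → Graph n → Set
C4-free G = ∀ a b c d → a ≢ c → b ≢ d →
  Edge (adj G) a b → Edge (adj G) b c → Edge (adj G) c d → Edge (adj G) d a →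
  Data.Empty.⊥
  where import Data.Empty

one : Fin 2
one = suc zero

Symmetric : ∀ {n} → (Fin n → Fin n → Bool) → Set
Symmetric R = ∀ u v → R u v ≡ R v u

IsMatching : ∀ {n} → (Fin n → Fin n → Bool) → Set
IsMatching R = ∀ u v w → Edge R u v → Edge R u w → v ≡ w

DeletableMatching : ∀ {n} → Graph n → (d* : Fin n → Fin 2) → (Fin n → Fin n → Bool) → Set
DeletableMatching G d* D =
  Symmetric D × IsMatching D ×
  (∀ u v → Edge D u v → Edge (adj G) u v × d* u ≡ one × d* v ≡ one)

-- A is a matching of addable non-edges of G (non-edges join distinct vertices)
AddableMatching : ∀ {n} → Graph n → (a* : Fin n → Fin 2) → (Fin n → Fin n → Bool) → Set
AddableMatching G a* A =
  Symmetric A × IsMatching A ×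
  (∀ u v → Edge A u v → u ≢ v × adj G u v ≡ false × a* u ≡ one × a* v ≡ one)

minusAdj : ∀ {n} → Graph n → (Fin n → Fin n → Bool) → Fin n → Fin n → Bool
minusAdj G D u v = adj G u v ∧ not (D u v)

editAdj : ∀ {n} → Graph n → (D A : Fin n → Fin n → Bool) → Fin n → Fin n → Bool
editAdj G D A u v = minusAdj G D u v ∨ A u v

-- a graph (given by adjacency relation H) is a vertex-disjoint union of cliques:
-- any two vertices in the same connected component are adjacent
IsClusterGraph : ∀ {n} → (Fin n → Fin n → Bool) → Set
IsClusterGraph H = ∀ u v → Star (Edge H) u v → u ≢ v → Edge H u v

YesInstance : ∀ {n} → Graph n → (a* d* : Fin n → Fin 2) → Set
YesInstance G a* d* =
  Σ (Fin _ → Fin _ → Bool) λ D → Σ (Fin _ → Fin _ → Bool) λ A →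
    DeletableMatching G d* D × AddableMatching G a* A × IsClusterGraph (editAdj G D A)

PathAdj : ∀ {k} → Fin k → Fin k → Set
PathAdj i j = toℕ i ≡ suc (toℕ j) ⊎ toℕ j ≡ suc (toℕ i)

ComponentIsPathVia : ∀ {n} → (Fin n → Fin n → Bool) → Fin n → (k : ℕ) → (Fin k → Fin n) → Set
ComponentIsPathVia H v k f =
  Injective _≡_ _≡_ f ×
  (∀ w → Star (Edge H) v w ⇔ ∃ λ i → f i ≡ w) ×
  (∀ i j → Edge H (f i) (f j) ⇔ PathAdj i j)

GoodDeletion : ∀ {n} → Graph n → (a* : Fin n → Fin 2) → (Fin n → Fin n → Bool) → Set
GoodDeletion G a* D = ∀ v →
  (∃ λ (f : Fin 1 → Fin _) → ComponentIsPathVia (minusAdj G D) v 1 f) ⊎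
  (∃ λ (f : Fin 2 → Fin _) → ComponentIsPathVia (minusAdj G D) v 2 f) ⊎
  (∃ λ (f : Fin 3 → Fin _) → ComponentIsPathVia (minusAdj G D) v 3 f ×
       adj G (f zero) (f (suc (suc zero))) ≡ false ×
       a* (f zero) ≡ one × a* (f (suc (suc zero))) ≡ one)

-- Let M = G - D. If G - D + A is a cluster graph, any two M-neighbours u, w of a
-- vertex v lie in one cluster but are not adjacent in G (no C₃), so uw ∈ A.
-- As A is a matching, every vertex has at most two M-neighbours, and if v has two
-- then each of them has no M-neighbour besides v: a further neighbour x of u
-- would be joined to w in G - D + A, not by A (A already matches w with u),
-- hence in M, closing the 4-cycle v u x w. So the components of M are P₁, P₂ or
-- P₃ whose end-vertices are matched by A, hence addable. Conversely, if every
-- component of M is such a path, take A to be the pairs at distance two in M: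
-- these are exactly the end pairs of the P₃-components, which form a matching of
-- addable non-edges, and M + A turns every component into a clique.
module Submission where

open import Defs
open import Data.Nat using (suc)
import Data.Nat as ℕ
open import Data.Nat.Properties using (1+n≢n)
open import Data.Bool using (Bool; true; false; _∨_)
open import Data.Bool.Properties using (∨-zeroʳ) renaming (_≟_ to _≟ᵇ_)
open import Data.Fin using (Fin; zero; suc; toℕ)
open import Data.Fin.Properties using (any?; all?) renaming (_≟_ to _≟ᶠ_)
open import Data.Vec.Functional using ([]; _∷_)
open import Data.Product using (Σ; ∃; _×_; _,_; proj₁; proj₂; map₁)
open import Data.Sum using (_⊎_; inj₁; inj₂; [_,_])
open import Data.Unit using (tt)
open import Data.Empty using (⊥; ⊥-elim)
open import Function using (_∘_)
open import Function.Bundles using (_⇔_; mk⇔; Equivalence)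
open import Function.Definitions using (Injective)
open import Relation.Nullary using (Dec; yes; no; ¬_; does; contradiction)
open import Relation.Nullary.Decidable
  using (_×-dec_; _⊎-dec_; _→-dec_; ¬?; toWitness; dec-true; does-⇔)
open import Relation.Binary.PropositionalEquality hiding ([_])
open import Relation.Binary.Construct.Closure.ReflexiveTransitive
  using (Star; ε; _◅_; fold; kleisliStar)
import Relation.Binary.Construct.Closure.ReflexiveTransitive as Star

open Equivalence using (to; from)

∨-elim : ∀ {x y} → x ∨ y ≡ true → x ≡ true ⊎ y ≡ true
∨-elim {true}  _ = inj₁ refl
∨-elim {false} e = inj₂ e

∨-introˡ : ∀ {x} y → x ≡ true → x ∨ y ≡ true
∨-introˡ y refl = refl

∨-introʳ : ∀ x {y} → y ≡ true → x ∨ y ≡ true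
∨-introʳ x refl = ∨-zeroʳ x

does-sound : ∀ {P : Set} (P? : Dec P) → does P? ≡ true → P
does-sound (yes p) _ = p

pattern mid = suc zero
pattern end = suc (suc zero)

pathAdj? : ∀ {k} (i j : Fin k) → Dec (PathAdj i j)
pathAdj? i j = (toℕ i ℕ.≟ suc (toℕ j)) ⊎-dec (toℕ j ℕ.≟ suc (toℕ i))

PathAdj-irrefl : ∀ {k} (i : Fin k) → ¬ PathAdj i i
PathAdj-irrefl i = [ 1+n≢n ∘ sym , 1+n≢n ∘ sym ]

P₁-edgeless : (i j : Fin 1) → ¬ PathAdj i j
P₁-edgeless zero zero = PathAdj-irrefl {k = 1} zero

P₂-complete : (i j : Fin 2) → i ≢ j → PathAdj i j
P₂-complete = toWitness {a? = all? λ i → all? λ j → ¬? (i ≟ᶠ j) →-dec pathAdj? i j} tt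

P₂-no-wedge : (i j k : Fin 2) → PathAdj i j → PathAdj j k → i ≢ k → ⊥
P₂-no-wedge = toWitness {a? = all? λ i → all? λ j → all? λ k →
  pathAdj? i j →-dec pathAdj? j k →-dec ¬? (i ≟ᶠ k) →-dec no λ ()} tt

P₃-wedge-ends : (i j k : Fin 3) → PathAdj i j → PathAdj j k → i ≢ k →
  (i ≡ zero × k ≡ end) ⊎ (i ≡ end × k ≡ zero)
P₃-wedge-ends = toWitness {a? = all? λ i → all? λ j → all? λ k →
  pathAdj? i j →-dec pathAdj? j k →-dec ¬? (i ≟ᶠ k) →-dec
  ((i ≟ᶠ zero ×-dec k ≟ᶠ end) ⊎-dec (i ≟ᶠ end ×-dec k ≟ᶠ zero))} tt

P₃-diameter-two : (i k : Fin 3) → i ≢ k → PathAdj i k ⊎ (PathAdj i mid × PathAdj mid k)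
P₃-diameter-two = toWitness {a? = all? λ i → all? λ k →
  ¬? (i ≟ᶠ k) →-dec (pathAdj? i k ⊎-dec (pathAdj? i mid ×-dec pathAdj? mid k))} tt

Image : ∀ {n k} → (Fin k → Fin n) → Fin n → Set
Image f w = ∃ λ i → f i ≡ w

module PathComponents {n} (R : Fin n → Fin n → Bool)
                      (R-sym : Symmetric R) (R-irrefl : ∀ v → R v v ≡ false) where

  Connected : Fin n → Fin n → Set
  Connected = Star (Edge R)

  edge-sym : ∀ {u v} → Edge R u v → Edge R v u
  edge-sym {u} {v} e = trans (R-sym v u) e

  edge⇒≢ : ∀ {u v} → Edge R u v → u ≢ v
  edge⇒≢ {u} e refl with () ← trans (sym e) (R-irrefl u)

  loop⇔PathAdj : ∀ {x k} (i : Fin k) → Edge R x x ⇔ PathAdj i i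
  loop⇔PathAdj i = mk⇔ (λ e → contradiction refl (edge⇒≢ e)) (⊥-elim ∘ PathAdj-irrefl i)

  -- GoodDeletion G a* D unfolds to ∀ v → SmallPathComponent (Addable G a*) v for R = G - D.
  SmallPathComponent : (Fin n → Fin n → Set) → Fin n → Set
  SmallPathComponent Q v =
    (∃ λ (f : Fin 1 → Fin n) → ComponentIsPathVia R v 1 f) ⊎
    (∃ λ (f : Fin 2 → Fin n) → ComponentIsPathVia R v 2 f) ⊎
    (∃ λ (f : Fin 3 → Fin n) → ComponentIsPathVia R v 3 f × Q (f zero) (f end))

  closed-image⇒component : ∀ {k v} (f : Fin k → Fin n) → Image f v →
    (∀ {x y} → Image f x → Edge R x y → Image f y) → (∀ i → Connected v (f i)) →
    ∀ w → Connected v w ⇔ Image f w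
  closed-image⇒component f v∈f closed reach w = mk⇔
    (λ c → fold (λ x y → Image f x → Image f y) (λ e k p → k (closed p e)) (λ p → p) c v∈f)
    (λ { (i , refl) → reach i })

  component-via-edge : ∀ {u v k f} → Edge R v u →
    ComponentIsPathVia R u k f → ComponentIsPathVia R v k f
  component-via-edge vu (injective , reach , iso) =
    injective , (λ w → mk⇔ (λ c → to (reach w) (edge-sym vu ◅ c)) (λ p → vu ◅ from (reach w) p)) , iso

  isolated⇒P₁ : ∀ v → (∀ w → ¬ Edge R v w) → ComponentIsPathVia R v 1 (v ∷ [])
  isolated⇒P₁ v isolated =
    (λ { {zero} {zero} _ → refl }) ,
    closed-image⇒component _ (zero , refl) (λ { (zero , refl) e → ⊥-elim (isolated _ e) })
      (λ { zero → ε }) ,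
    λ { zero zero → loop⇔PathAdj {k = 1} zero }

  P₂ : ∀ {a b} → Edge R a b → (∀ x → Edge R a x → x ≡ b) → (∀ x → Edge R b x → x ≡ a) →
       ComponentIsPathVia R a 2 (a ∷ b ∷ [])
  P₂ {a} {b} ab a-only b-only = injective , closed-image⇒component _ (zero , refl) closed reach , iso
    where
    injective : Injective _≡_ _≡_ (a ∷ b ∷ [])
    injective {zero} {zero} _ = refl
    injective {zero} {mid}  p = contradiction p (edge⇒≢ ab)
    injective {mid}  {zero} p = contradiction (sym p) (edge⇒≢ ab)
    injective {mid}  {mid}  _ = refl
    closed : ∀ {x y} → Image (a ∷ b ∷ []) x → Edge R x y → Image (a ∷ b ∷ []) y
    closed (zero , refl) e = mid , sym (a-only _ e)
    closed (mid  , refl) e = zero , sym (b-only _ e)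
    reach : ∀ i → Connected a ((a ∷ b ∷ []) i)
    reach zero = ε
    reach mid  = ab ◅ ε
    iso : ∀ i j → Edge R ((a ∷ b ∷ []) i) ((a ∷ b ∷ []) j) ⇔ PathAdj i j
    iso zero zero = loop⇔PathAdj {k = 2} zero
    iso zero mid  = mk⇔ (λ _ → inj₂ refl) (λ _ → ab)
    iso mid  zero = mk⇔ (λ _ → inj₁ refl) (λ _ → edge-sym ab)
    iso mid  mid  = loop⇔PathAdj {k = 2} mid

  P₃ : ∀ {a b c} → Edge R a b → Edge R b c → a ≢ c →
       (∀ x → Edge R a x → x ≡ b) → (∀ x → Edge R c x → x ≡ b) →
       (∀ x → Edge R b x → x ≡ a ⊎ x ≡ c) →
       ComponentIsPathVia R b 3 (a ∷ b ∷ c ∷ [])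
  P₃ {a} {b} {c} ab bc a≢c a-only c-only b-only =
    injective , closed-image⇒component _ (mid , refl) closed reach , iso
    where
    f : Fin 3 → Fin n
    f = a ∷ b ∷ c ∷ []
    injective : Injective _≡_ _≡_ f
    injective {zero} {zero} _ = refl
    injective {zero} {mid}  p = contradiction p (edge⇒≢ ab)
    injective {zero} {end}  p = contradiction p a≢c
    injective {mid}  {zero} p = contradiction (sym p) (edge⇒≢ ab)
    injective {mid}  {mid}  _ = refl
    injective {mid}  {end}  p = contradiction p (edge⇒≢ bc)
    injective {end}  {zero} p = contradiction (sym p) a≢c
    injective {end}  {mid}  p = contradiction (sym p) (edge⇒≢ bc)
    injective {end}  {end}  _ = refl
    closed : ∀ {x y} → Image f x → Edge R x y → Image f y
    closed (zero , refl) e = mid , sym (a-only _ e)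
    closed (mid  , refl) e with b-only _ e
    ... | inj₁ refl = zero , refl
    ... | inj₂ refl = end , refl
    closed (end  , refl) e = mid , sym (c-only _ e)
    reach : ∀ i → Connected b (f i)
    reach zero = edge-sym ab ◅ ε
    reach mid  = ε
    reach end  = bc ◅ ε
    ¬ac : ¬ Edge R a c
    ¬ac e = edge⇒≢ bc (sym (a-only _ e))
    iso : ∀ i j → Edge R (f i) (f j) ⇔ PathAdj i j
    iso zero zero = loop⇔PathAdj {k = 3} zero
    iso zero mid  = mk⇔ (λ _ → inj₂ refl) (λ _ → ab)
    iso zero end  = mk⇔ (⊥-elim ∘ ¬ac) λ { (inj₁ ()) ; (inj₂ ()) }
    iso mid  zero = mk⇔ (λ _ → inj₁ refl) (λ _ → edge-sym ab)
    iso mid  mid  = loop⇔PathAdj {k = 3} mid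
    iso mid  end  = mk⇔ (λ _ → inj₂ refl) (λ _ → bc)
    iso end  zero = mk⇔ (⊥-elim ∘ ¬ac ∘ edge-sym) λ { (inj₁ ()) ; (inj₂ ()) }
    iso end  mid  = mk⇔ (λ _ → inj₁ refl) (λ _ → edge-sym bc)
    iso end  end  = loop⇔PathAdj {k = 3} end

  OtherNeighbour : Fin n → Fin n → Set
  OtherNeighbour v u = ∃ λ w → Edge R v w × w ≢ u

  otherNeighbour? : ∀ v u → Dec (OtherNeighbour v u)
  otherNeighbour? v u = any? λ w → (R v w ≟ᵇ true) ×-dec ¬? (w ≟ᶠ u)

  sole-neighbour : ∀ {v u} → ¬ OtherNeighbour v u → ∀ x → Edge R v x → x ≡ u
  sole-neighbour {u = u} none x e with x ≟ᶠ u
  ... | yes x≡u = x≡u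
  ... | no  x≢u = ⊥-elim (none (x , e , x≢u))

  module Classification (Q : Fin n → Fin n → Set)
    (wedge⇒Q : ∀ {v u w} → Edge R v u → Edge R v w → u ≢ w → Q u w)
    (wedge-centre : ∀ {v u w} → Edge R v u → Edge R v w → u ≢ w →
                    ∀ x → Edge R v x → x ≡ u ⊎ x ≡ w)
    (wedge-leaf : ∀ {v u w} → Edge R v u → Edge R v w → u ≢ w →
                  ∀ x → Edge R u x → x ≡ v) where

    wedge⇒P₃ : ∀ {v u w} → Edge R v u → Edge R v w → u ≢ w →
               ComponentIsPathVia R v 3 (u ∷ v ∷ w ∷ []) × Q u w
    wedge⇒P₃ vu vw u≢w =
      P₃ (edge-sym vu) vw u≢w (wedge-leaf vu vw u≢w) (wedge-leaf vw vu (≢-sym u≢w))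
         (wedge-centre vu vw u≢w) ,
      wedge⇒Q vu vw u≢w

    small-path-component : ∀ v → SmallPathComponent Q v
    small-path-component v with any? (λ u → R v u ≟ᵇ true)
    ... | no isolated = inj₁ (_ , isolated⇒P₁ v λ w e → isolated (w , e))
    ... | yes (u , vu) with otherNeighbour? v u
    ...   | yes (w , vw , w≢u) = inj₂ (inj₂ (_ , wedge⇒P₃ vu vw (≢-sym w≢u)))
    ...   | no v-only with otherNeighbour? u v
    ...     | yes (x , ux , x≢v) =
      inj₂ (inj₂ (_ , map₁ (component-via-edge vu) (wedge⇒P₃ (edge-sym vu) ux (≢-sym x≢v))))
    ...     | no u-only = inj₂ (inj₁ (_ , P₂ vu (sole-neighbour v-only) (sole-neighbour u-only)))

  TwoStep : Fin n → Fin n → Set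
  TwoStep u v = u ≢ v × ∃ λ w → Edge R u w × Edge R w v

  twoStep? : ∀ u v → Dec (TwoStep u v)
  twoStep? u v = ¬? (u ≟ᶠ v) ×-dec any? λ w → (R u w ≟ᵇ true) ×-dec (R w v ≟ᵇ true)

  twoStep : Fin n → Fin n → Bool
  twoStep u v = does (twoStep? u v)

  TwoStep-sym : ∀ {u v} → TwoStep u v → TwoStep v u
  TwoStep-sym (u≢v , w , uw , wv) = ≢-sym u≢v , w , edge-sym wv , edge-sym uw

  twoStep-sym : Symmetric twoStep
  twoStep-sym u v = does-⇔ (mk⇔ TwoStep-sym TwoStep-sym) (twoStep? u v) (twoStep? v u)

  locate : ∀ {u k f w} → ComponentIsPathVia R u k f → Connected u w → Image f w
  locate {w = w} (_ , reach , _) c = to (reach w) c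

  edge⇒PathAdj : ∀ {u k f} → ComponentIsPathVia R u k f → ∀ {i j} →
                 Edge R (f i) (f j) → PathAdj i j
  edge⇒PathAdj (_ , _ , iso) {i} {j} = to (iso i j)

  PathAdj⇒edge : ∀ {u k f} → ComponentIsPathVia R u k f → ∀ {i j} →
                 PathAdj i j → Edge R (f i) (f j)
  PathAdj⇒edge (_ , _ , iso) {i} {j} = from (iso i j)

  wedge-indices : ∀ {u v k f} → ComponentIsPathVia R u k f → TwoStep u v →
    ∃ λ i → ∃ λ j → ∃ λ l → f i ≡ u × f l ≡ v × PathAdj i j × PathAdj j l × i ≢ l
  wedge-indices {f = f} c (u≢v , m , um , mv)
    with locate c ε | locate c (um ◅ ε) | locate c (um ◅ mv ◅ ε)
  ... | i , refl | j , refl | l , refl =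
    i , j , l , refl , refl , edge⇒PathAdj c um , edge⇒PathAdj c mv , u≢v ∘ cong f

  P₃-wedge : ∀ {u v f} → ComponentIsPathVia R u 3 f → TwoStep u v →
             (f zero ≡ u × f end ≡ v) ⊎ (f end ≡ u × f zero ≡ v)
  P₃-wedge c t with wedge-indices c t
  ... | i , j , l , fi , fl , ij , jl , i≢l with P₃-wedge-ends i j l ij jl i≢l
  ...   | inj₁ (refl , refl) = inj₁ (fi , fl)
  ...   | inj₂ (refl , refl) = inj₂ (fi , fl)

  module FromSmallComponents (Q : Fin n → Fin n → Set) (Q-sym : ∀ {u v} → Q u v → Q v u)
    (small : ∀ v → SmallPathComponent Q v) where

    TwoStep⇒P₃ : ∀ {u v} → TwoStep u v →
                 ∃ λ f → ComponentIsPathVia R u 3 f × Q (f zero) (f end)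
    TwoStep⇒P₃ {u} t with small u
    ... | inj₁ (_ , c) with wedge-indices c t
    ...   | i , j , _ , _ , _ , ij , _ = ⊥-elim (P₁-edgeless i j ij)
    TwoStep⇒P₃ {u} t | inj₂ (inj₁ (_ , c)) with wedge-indices c t
    ...   | i , j , l , _ , _ , ij , jl , i≢l = ⊥-elim (P₂-no-wedge i j l ij jl i≢l)
    TwoStep⇒P₃ {u} t | inj₂ (inj₂ p) = p

    TwoStep⇒Q : ∀ {u v} → TwoStep u v → Q u v
    TwoStep⇒Q t with TwoStep⇒P₃ t
    ... | f , c , q with P₃-wedge c t
    ...   | inj₁ (refl , refl) = q
    ...   | inj₂ (refl , refl) = Q-sym q

    twoStep-matching : IsMatching twoStep
    twoStep-matching u v w uv uw with does-sound (twoStep? u v) uv | does-sound (twoStep? u w) uw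
    ... | tv | tw with TwoStep⇒P₃ tv
    ...   | _ , c , _ with P₃-wedge c tv | P₃-wedge c tw
    ...     | inj₁ (_ , refl) | inj₁ (_ , refl) = refl
    ...     | inj₂ (_ , refl) | inj₂ (_ , refl) = refl
    ...     | inj₁ (refl , _) | inj₂ (f2≡u , _) with () ← proj₁ c f2≡u
    ...     | inj₂ (refl , _) | inj₁ (f0≡u , _) with () ← proj₁ c f0≡u

    within-distance-two : ∀ {u v} → Connected u v → u ≢ v → Edge R u v ⊎ TwoStep u v
    within-distance-two {u} s u≢v with small u
    ... | inj₁ (f , c) with locate c ε | locate c s
    ...   | zero , refl | zero , refl = contradiction refl u≢v
    within-distance-two {u} s u≢v | inj₂ (inj₁ (f , c)) with locate c ε | locate c s
    ...   | i , refl | k , refl = inj₁ (PathAdj⇒edge c (P₂-complete i k (u≢v ∘ cong f)))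
    within-distance-two {u} s u≢v | inj₂ (inj₂ (f , c , _)) with locate c ε | locate c s
    ...   | i , refl | k , refl with P₃-diameter-two i k (u≢v ∘ cong f)
    ...     | inj₁ ik = inj₁ (PathAdj⇒edge c ik)
    ...     | inj₂ (im , mk) = inj₂ (u≢v , f mid , PathAdj⇒edge c im , PathAdj⇒edge c mk)

    completion-edge⇒connected : ∀ {x y} → Edge (λ u v → R u v ∨ twoStep u v) x y → Connected x y
    completion-edge⇒connected {x} {y} e with ∨-elim e
    ... | inj₁ xy = xy ◅ ε
    ... | inj₂ t with does-sound (twoStep? x y) t
    ...   | _ , m , xm , my = xm ◅ my ◅ ε

    twoStep-completion-is-cluster : IsClusterGraph (λ u v → R u v ∨ twoStep u v)
    twoStep-completion-is-cluster u v s u≢v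
      with within-distance-two (kleisliStar (λ x → x) completion-edge⇒connected s) u≢v
    ... | inj₁ uv = ∨-introˡ _ uv
    ... | inj₂ t = ∨-introʳ (R u v) (dec-true (twoStep? u v) t)

    twoStep⇒≢×Q : ∀ u v → Edge twoStep u v → u ≢ v × Q u v
    twoStep⇒≢×Q u v e with does-sound (twoStep? u v) e
    ... | t = proj₁ t , TwoStep⇒Q t

minusAdj-sym : ∀ {n} (G : Graph n) {D} → Symmetric D → Symmetric (minusAdj G D)
minusAdj-sym G D-sym u v rewrite adj-sym G u v | D-sym u v = refl

minusAdj-irrefl : ∀ {n} (G : Graph n) D v → minusAdj G D v v ≡ false
minusAdj-irrefl G D v rewrite irrefl G v = refl

Addable : ∀ {n} → Graph n → (Fin n → Fin 2) → Fin n → Fin n → Set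
Addable G a* u w = adj G u w ≡ false × a* u ≡ one × a* w ≡ one

Addable-sym : ∀ {n} (G : Graph n) a* {u w} → Addable G a* u w → Addable G a* w u
Addable-sym G a* {u} {w} (¬uw , au , aw) = trans (adj-sym G w u) ¬uw , aw , au

module FromClusterEditing {n} (G : Graph n) (a* : Fin n → Fin 2)
  (c3 : C3-free G) (c4 : C4-free G) (D A : Fin n → Fin n → Bool) (D-sym : Symmetric D)
  (A-addable : AddableMatching G a* A) (cluster : IsClusterGraph (editAdj G D A)) where

  open PathComponents (minusAdj G D) (minusAdj-sym G D-sym) (minusAdj-irrefl G D)

  M : Fin n → Fin n → Bool
  M = minusAdj G D

  M⇒adj : ∀ {u v} → Edge M u v → Edge (adj G) u v
  M⇒adj {u} {v} e with adj G u v
  ... | true = refl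

  A-matching : IsMatching A
  A-matching = proj₁ (proj₂ A-addable)

  A⇒Addable : ∀ {u w} → Edge A u w → Addable G a* u w
  A⇒Addable {u} {w} e = proj₂ (proj₂ (proj₂ A-addable) u w e)

  A⇒¬adj : ∀ {u w} → Edge A u w → ¬ Edge (adj G) u w
  A⇒¬adj e uw with () ← trans (sym uw) (proj₁ (A⇒Addable e))

  same-component⇒edited-edge : ∀ {x y} → Connected x y → x ≢ y → Edge (editAdj G D A) x y
  same-component⇒edited-edge {x} {y} s = cluster x y (Star.map (∨-introˡ _) s)

  wedge⇒added : ∀ {v u w} → Edge M v u → Edge M v w → u ≢ w → Edge A u w
  wedge⇒added {v} {u} {w} vu vw u≢w
    with ∨-elim (same-component⇒edited-edge (edge-sym vu ◅ vw ◅ ε) u≢w)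
  ... | inj₁ uw    = ⊥-elim (c3 u w v (M⇒adj uw) (M⇒adj (edge-sym vw)) (M⇒adj vu))
  ... | inj₂ added = added

  wedge-centre : ∀ {v u w} → Edge M v u → Edge M v w → u ≢ w →
                 ∀ x → Edge M v x → x ≡ u ⊎ x ≡ w
  wedge-centre {v} {u} {w} vu vw u≢w x vx with x ≟ᶠ u | x ≟ᶠ w
  ... | yes x≡u | _       = inj₁ x≡u
  ... | no  _   | yes x≡w = inj₂ x≡w
  ... | no  x≢u | no  x≢w =
    contradiction (A-matching u w x (wedge⇒added vu vw u≢w) (wedge⇒added vu vx (≢-sym x≢u)))
                  (≢-sym x≢w)

  wedge-leaf : ∀ {v u w} → Edge M v u → Edge M v w → u ≢ w → ∀ x → Edge M u x → x ≡ v
  wedge-leaf {v} {u} {w} vu vw u≢w x ux with x ≟ᶠ v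
  ... | yes x≡v = x≡v
  ... | no  x≢v =
    ⊥-elim (c4 v u x w (≢-sym x≢v) u≢w (M⇒adj vu) (M⇒adj ux) (M⇒adj (edge-sym wx)) (M⇒adj (edge-sym vw)))
    where
    uw : Edge A u w
    uw = wedge⇒added vu vw u≢w
    x≢w : x ≢ w
    x≢w refl = A⇒¬adj uw (M⇒adj ux)
    wx : Edge M w x
    wx with ∨-elim (same-component⇒edited-edge (edge-sym vw ◅ vu ◅ ux ◅ ε) (≢-sym x≢w))
    ... | inj₁ kept  = kept
    ... | inj₂ added = contradiction (A-matching w u x (trans (proj₁ A-addable w u) uw) added)
                                     (edge⇒≢ ux)

  deletion-is-good : GoodDeletion G a* D
  deletion-is-good =
    Classification.small-path-component (Addable G a*)
      (λ vu vw u≢w → A⇒Addable (wedge⇒added vu vw u≢w)) wedge-centre wedge-leaf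

module DistanceTwoCompletion {n} (G : Graph n) (a* : Fin n → Fin 2)
  (D : Fin n → Fin n → Bool) (D-sym : Symmetric D) (good : GoodDeletion G a* D) where

  open PathComponents (minusAdj G D) (minusAdj-sym G D-sym) (minusAdj-irrefl G D) public
  open FromSmallComponents (Addable G a*) (Addable-sym G a*) good public

  twoStep-addable : AddableMatching G a* twoStep
  twoStep-addable = twoStep-sym , twoStep-matching , twoStep⇒≢×Q

lemma6 : ∀ {n} (G : Graph n) (a* d* : Fin n → Fin 2) →
    C3-free G → C4-free G → MaxDegreeAtMost G 3 →
    (YesInstance G a* d* ⇔
    Σ (Fin n → Fin n → Bool) λ D → DeletableMatching G d* D × GoodDeletion G a* D)
lemma6 G a* d* c3 c4 _ = mk⇔
  (λ { (D , A , deletable , addable , cluster) →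
       D , deletable ,
       FromClusterEditing.deletion-is-good G a* c3 c4 D A (proj₁ deletable) addable cluster })
  (λ { (D , deletable , good) →
       let open DistanceTwoCompletion G a* D (proj₁ deletable) good in
       D , twoStep , deletable , twoStep-addable , twoStep-completion-is-cluster })
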